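{- Let $n_1,n_2,n_3\ge 2$ and let $u=(x_1,x_2,x_3)$, $v=(y_1,y_2,y_3)$ be two distinct vertices of $P_{n_1}\Box P_{n_2}\Box P_{n_3}$ with $x_i=y_i$ for exactly one $i\in\{1,2,3\}$. Then there are at least $\alpha_M(n_1,n_2,n_3)$ vertices of $F(n_1,n_2,n_3)$ resolving $u$ and $v$.
   Context: $P_{n_1}\Box P_{n_2}\Box P_{n_3}$ is the grid graph with vertex set $\{(x_1,x_2,x_3): 0\le x_i\le n_i-1\}$, two vertices adjacent iff they differ by exactly $1$ in exactly one coordinate; $d(x,y)=\sum_i|x_i-y_i|$. A vertex $w$ resolves $u,v$ if $d(w,u)\ne d(w,v)$. $F(n_1,n_2,n_3)=\{(x_1,x_2,x_3): x_i\in\{0,n_i-1\}\text{ for some }i\}$. $\alpha_M(n_1,n_2,n_3)=\min\{n_1(n_2+n_3-2),n_2(n_1+n_3-2),n_3(n_1+n_2-2)\}$. -}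

module Defs where

open import Data.Nat using (ℕ; zero; suc; _+_; _*_; _∸_; ∣_-_∣; _⊓_; _≡ᵇ_)
open import Data.Fin using (Fin; toℕ)
open import Data.Product using (_×_; _,_)
open import Data.Bool using (Bool; true; false; _∨_; not)
open import Data.List using (List; length; filterᵇ; cartesianProduct; allFin)

Vertex : ℕ → ℕ → ℕ → Set
Vertex n₁ n₂ n₃ = Fin n₁ × Fin n₂ × Fin n₃

dist : ∀ {n₁ n₂ n₃} → Vertex n₁ n₂ n₃ → Vertex n₁ n₂ n₃ → ℕ
dist (x₁ , x₂ , x₃) (y₁ , y₂ , y₃) =
  ∣ toℕ x₁ - toℕ y₁ ∣ + ∣ toℕ x₂ - toℕ y₂ ∣ + ∣ toℕ x₃ - toℕ y₃ ∣

allVertices : ∀ n₁ n₂ n₃ → List (Vertex n₁ n₂ n₃)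
allVertices n₁ n₂ n₃ =
  cartesianProduct (allFin n₁) (cartesianProduct (allFin n₂) (allFin n₃))

resolvesᵇ : ∀ {n₁ n₂ n₃} → Vertex n₁ n₂ n₃ → Vertex n₁ n₂ n₃ → Vertex n₁ n₂ n₃ → Bool
resolvesᵇ w u v = not (dist w u ≡ᵇ dist w v)

extremeᵇ : ∀ {n} → Fin n → Bool
extremeᵇ {n} x = (toℕ x ≡ᵇ 0) ∨ (toℕ x ≡ᵇ (n ∸ 1))

inFᵇ : ∀ {n₁ n₂ n₃} → Vertex n₁ n₂ n₃ → Bool
inFᵇ (x₁ , x₂ , x₃) = extremeᵇ x₁ ∨ extremeᵇ x₂ ∨ extremeᵇ x₃

numResolvingInF : ∀ n₁ n₂ n₃ → Vertex n₁ n₂ n₃ → Vertex n₁ n₂ n₃ → ℕ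
numResolvingInF n₁ n₂ n₃ u v =
  length (filterᵇ (λ w → inFᵇ w Data.Bool.∧ resolvesᵇ w u v) (allVertices n₁ n₂ n₃))

αM : ℕ → ℕ → ℕ → ℕ
αM n₁ n₂ n₃ =
  (n₁ * (n₂ + n₃ ∸ 2)) ⊓ (n₂ * (n₁ + n₃ ∸ 2)) ⊓ (n₃ * (n₁ + n₂ ∸ 2))

b2n : Bool → ℕ
b2n true = 1
b2n false = 0

numEqualCoords : ∀ {n₁ n₂ n₃} → Vertex n₁ n₂ n₃ → Vertex n₁ n₂ n₃ → ℕ
numEqualCoords (x₁ , x₂ , x₃) (y₁ , y₂ , y₃) =
  b2n (toℕ x₁ ≡ᵇ toℕ y₁) + b2n (toℕ x₂ ≡ᵇ toℕ y₂) + b2n (toℕ x₃ ≡ᵇ toℕ y₃)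

-- Suppose u and v differ in coordinates 2 and 3. Move a vertex w along axis 3 to the two
-- opposite faces where its third coordinate is 0 and n₃ - 1: both lie in F, the distances
-- to u and v along the other axes stay put, while those along axis 3 sum to n₃ - 1 for
-- each of u and v, so if neither endpoint resolved u,v then u and v would agree in
-- coordinate 3. Hence every such pair of opposite vertices contains a resolving vertex,
-- and likewise along axis 2. In each slice {i} × P_{n₂} × P_{n₃} the boundary of the
-- rectangle splits into n₂ + n₃ - 2 disjoint such pairs, giving n₁(n₂ + n₃ - 2) resolving
-- vertices. The other two cases are symmetric and give the other two terms of α_M.
module Submission where

open import Defs
open import Data.Nat.Properties
open import Algebra.Properties.CommutativeMonoid.Sum +-0-commutativeMonoid
  using (sum-syntax; sum-cong-≗; sum-init-last; ∑-comm; ∑-distrib-+)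
open import Algebra.Properties.CommutativeSemigroup +-commutativeSemigroup
  using (interchange; x∙yz≈y∙xz; xy∙z≈xz∙y; xy∙z≈yz∙x)
open import Data.Bool using (Bool; true; false; _∧_; not; T)
open import Data.Bool.Properties using (T-∨)
open import Data.Empty using (⊥; ⊥-elim)
open import Data.Fin using (Fin; zero; suc; toℕ; fromℕ; inject₁)
open import Data.Fin.Properties using (toℕ-injective; toℕ-fromℕ; toℕ≤pred[n])
open import Data.List using (List; []; _∷_; _++_; map; length; filterᵇ; tabulate; allFin; cartesianProduct)
open import Data.List.Properties using (map-++; map-∘)
import Data.Nat.ListAction as L
open import Data.Nat.ListAction.Properties using (sum-++)
open import Data.Nat using (ℕ; zero; suc; _+_; _*_; _∸_; ∣_-_∣; _≡ᵇ_; _≤_; s≤s; z≤n)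
open import Data.Product using (_×_; _,_)
open import Data.Sum using (_⊎_; inj₁; inj₂)
open import Function using (_∘_; Equivalence)
open import Relation.Binary.PropositionalEquality
  using (_≡_; _≢_; refl; sym; trans; cong; cong₂; subst; subst₂; module ≡-Reasoning)

open Equivalence using (from)

length-filterᵇ : {A : Set} (p : A → Bool) (xs : List A) →
  length (filterᵇ p xs) ≡ L.sum (map (b2n ∘ p) xs)
length-filterᵇ p [] = refl
length-filterᵇ p (x ∷ xs) with p x
... | true = cong suc (length-filterᵇ p xs)
... | false = length-filterᵇ p xs

sum-map-cartesianProduct : {A B : Set} (f : A × B → ℕ) (xs : List A) (ys : List B) →
  L.sum (map f (cartesianProduct xs ys)) ≡ L.sum (map (λ x → L.sum (map (λ y → f (x , y)) ys)) xs)
sum-map-cartesianProduct f [] ys = refl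
sum-map-cartesianProduct f (x ∷ xs) ys = begin
  L.sum (map f (map (x ,_) ys ++ cartesianProduct xs ys))
    ≡⟨ cong L.sum (map-++ f (map (x ,_) ys) _) ⟩
  L.sum (map f (map (x ,_) ys) ++ map f (cartesianProduct xs ys))
    ≡⟨ sum-++ (map f (map (x ,_) ys)) _ ⟩
  L.sum (map f (map (x ,_) ys)) + L.sum (map f (cartesianProduct xs ys))
    ≡⟨ cong₂ _+_ (cong L.sum (sym (map-∘ ys))) (sum-map-cartesianProduct f xs ys) ⟩
  L.sum (map (λ y → f (x , y)) ys) + L.sum (map (λ x → L.sum (map (λ y → f (x , y)) ys)) xs) ∎
  where open ≡-Reasoning

sum-map-tabulate : ∀ {A : Set} {n} (f : A → ℕ) (g : Fin n → A) →
  L.sum (map f (tabulate g)) ≡ ∑[ i < n ] f (g i)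
sum-map-tabulate {n = zero} f g = refl
sum-map-tabulate {n = suc n} f g = cong (f (g zero) +_) (sum-map-tabulate f (g ∘ suc))

sum-map-allFin : ∀ {n} (f : Fin n → ℕ) → L.sum (map f (allFin n)) ≡ ∑[ i < n ] f i
sum-map-allFin f = sum-map-tabulate f (λ i → i)

sum-map-allFin² : ∀ {m n} (f : Fin m × Fin n → ℕ) →
  L.sum (map f (cartesianProduct (allFin m) (allFin n))) ≡ ∑[ i < m ] ∑[ j < n ] f (i , j)
sum-map-allFin² {m} {n} f = trans (sum-map-cartesianProduct f (allFin m) (allFin n))
  (trans (sum-map-allFin (λ i → L.sum (map (λ j → f (i , j)) (allFin n))))
         (sum-cong-≗ {m} (λ i → sum-map-allFin (λ j → f (i , j)))))

∑-lowerBound : ∀ {n c} (f : Fin n → ℕ) → (∀ i → c ≤ f i) → n * c ≤ ∑[ i < n ] f i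
∑-lowerBound {zero} f c≤f = z≤n
∑-lowerBound {suc n} f c≤f = +-mono-≤ (c≤f zero) (∑-lowerBound (f ∘ suc) (c≤f ∘ suc))

∑-ends : ∀ {n} (f : Fin (suc (suc n)) → ℕ) → f zero + f (fromℕ (suc n)) ≤ ∑[ i < suc (suc n) ] f i
∑-ends f = +-monoʳ-≤ (f zero)
  (≤-trans (m≤n+m _ _) (≤-reflexive (sym (sum-init-last (f ∘ suc)))))

-- The pairs of opposite boundary entries of the a interior rows and of the 2+b columns are disjoint.
∑-boundary-pairs : ∀ {a b} (h : Fin (suc (suc a)) → Fin (suc (suc b)) → ℕ) →
  (∀ p → 1 ≤ h p zero + h p (fromℕ (suc b))) →
  (∀ q → 1 ≤ h zero q + h (fromℕ (suc a)) q) →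
  a + suc (suc b) ≤ ∑[ p < suc (suc a) ] ∑[ q < suc (suc b) ] h p q
∑-boundary-pairs {a} {b} h rows columns = begin
  a + suc (suc b)                       ≤⟨ +-mono-≤ interior outer ⟩
  innerRows + (row zero + row lastRow)  ≡⟨ x∙yz≈y∙xz innerRows (row zero) (row lastRow) ⟩
  row zero + (innerRows + row lastRow)  ≡⟨ cong (row zero +_) (sym (sum-init-last (row ∘ suc))) ⟩
  ∑[ p < suc (suc a) ] row p            ∎
  where
  open ≤-Reasoning
  row : Fin (suc (suc a)) → ℕ
  row p = ∑[ q < suc (suc b) ] h p q
  lastRow : Fin (suc (suc a))
  lastRow = fromℕ (suc a)
  innerRows : ℕ
  innerRows = ∑[ p < a ] row (suc (inject₁ p))
  interior : a ≤ innerRows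
  interior = subst (_≤ innerRows) (*-identityʳ a)
    (∑-lowerBound _ (λ p → ≤-trans (rows _) (∑-ends (h (suc (inject₁ p))))))
  outer : suc (suc b) ≤ row zero + row lastRow
  outer = subst₂ _≤_ (*-identityʳ (suc (suc b))) (∑-distrib-+ (h zero) (h lastRow))
    (∑-lowerBound (λ q → h zero q + h lastRow q) columns)

m+m≡n+n⇒m≡n : ∀ {m n} → m + m ≡ n + n → m ≡ n
m+m≡n+n⇒m≡n {zero} {zero} _ = refl
m+m≡n+n⇒m≡n {suc m} {suc n} eq = cong suc (m+m≡n+n⇒m≡n
  (suc-injective (trans (sym (+-suc m m)) (trans (suc-injective eq) (+-suc n n)))))

-- Since z + ∣ L - z ∣ = L for z ≤ L, adding the two hypotheses gives 2P + L = 2P' + L.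
opposite-ends-separate : ∀ {L x y} P P' → x ≤ L → y ≤ L →
  P + x ≡ P' + y → P + ∣ L - x ∣ ≡ P' + ∣ L - y ∣ → x ≡ y
opposite-ends-separate {L} {x} {y} P P' x≤L y≤L e₀ e₁ =
  +-cancelˡ-≡ P x y (trans e₀ (cong (_+ y) (sym P≡P')))
  where
  pairSum : ∀ Q {z} → z ≤ L → (Q + z) + (Q + ∣ L - z ∣) ≡ (Q + Q) + L
  pairSum Q {z} z≤L = begin
    (Q + z) + (Q + ∣ L - z ∣) ≡⟨ interchange Q z Q ∣ L - z ∣ ⟩
    (Q + Q) + (z + ∣ L - z ∣) ≡⟨ cong (λ d → (Q + Q) + (z + d)) (m≤n⇒∣n-m∣≡n∸m z≤L) ⟩
    (Q + Q) + (z + (L ∸ z))   ≡⟨ cong ((Q + Q) +_) (m+[n∸m]≡n z≤L) ⟩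
    (Q + Q) + L               ∎
    where open ≡-Reasoning
  P≡P' : P ≡ P'
  P≡P' = m+m≡n+n⇒m≡n (+-cancelʳ-≡ L (P + P) (P' + P')
    (trans (sym (pairSum P x≤L)) (trans (cong₂ _+_ e₀ e₁) (pairSum P' y≤L))))

b2n-∧-T : ∀ {a} r → T a → b2n (a ∧ r) ≡ b2n r
b2n-∧-T {true} r _ = refl

b2n-≢ᵇ-either : ∀ a b a' b' → (a ≡ b → a' ≡ b' → ⊥) → 1 ≤ b2n (not (a ≡ᵇ b)) + b2n (not (a' ≡ᵇ b'))
b2n-≢ᵇ-either a b a' b' ¬both with a ≡ᵇ b in e | a' ≡ᵇ b' in e'
... | false | _ = s≤s z≤n
... | true | false = s≤s z≤n
... | true | true = ⊥-elim (¬both (≡ᵇ⇒≡ a b (subst T (sym e) _)) (≡ᵇ⇒≡ a' b' (subst T (sym e') _)))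

extremeᵇ-zero : ∀ {n} → T (extremeᵇ (zero {n}))
extremeᵇ-zero = _

extremeᵇ-fromℕ : ∀ n → T (extremeᵇ (fromℕ n))
extremeᵇ-fromℕ n = from T-∨ (inj₂ (subst (λ m → T (m ≡ᵇ n)) (sym (toℕ-fromℕ n)) (≡⇒≡ᵇ n n refl)))

module _ {n₁ n₂ n₃ : ℕ} (u v : Vertex n₁ n₂ n₃) where

  resolvingInFᵇ : Vertex n₁ n₂ n₃ → Bool
  resolvingInFᵇ w = inFᵇ w ∧ resolvesᵇ w u v

  resolverInF : Vertex n₁ n₂ n₃ → ℕ
  resolverInF w = b2n (resolvingInFᵇ w)

  numResolvingInF≡∑ : numResolvingInF n₁ n₂ n₃ u v ≡
    ∑[ i < n₁ ] ∑[ j < n₂ ] ∑[ k < n₃ ] resolverInF (i , j , k)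
  numResolvingInF≡∑ = begin
    length (filterᵇ resolvingInFᵇ (cartesianProduct (allFin n₁) rest))
      ≡⟨ length-filterᵇ resolvingInFᵇ (cartesianProduct (allFin n₁) rest) ⟩
    L.sum (map resolverInF (cartesianProduct (allFin n₁) rest))
      ≡⟨ sum-map-cartesianProduct resolverInF (allFin n₁) rest ⟩
    L.sum (map (λ i → L.sum (map (λ jk → resolverInF (i , jk)) rest)) (allFin n₁))
      ≡⟨ sum-map-allFin (λ i → L.sum (map (λ jk → resolverInF (i , jk)) rest)) ⟩
    ∑[ i < n₁ ] L.sum (map (λ jk → resolverInF (i , jk)) rest)
      ≡⟨ sum-cong-≗ {n₁} (λ i → sum-map-allFin² (λ jk → resolverInF (i , jk))) ⟩
    ∑[ i < n₁ ] ∑[ j < n₂ ] ∑[ k < n₃ ] resolverInF (i , j , k) ∎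
    where
    open ≡-Reasoning
    rest : List (Fin n₂ × Fin n₃)
    rest = cartesianProduct (allFin n₂) (allFin n₃)

  either-resolves : ∀ {w w'} → T (inFᵇ w) → T (inFᵇ w') →
    (dist w u ≡ dist w v → dist w' u ≡ dist w' v → ⊥) →
    1 ≤ resolverInF w + resolverInF w'
  either-resolves {w} {w'} w∈F w'∈F ¬both =
    subst (1 ≤_) (sym (cong₂ _+_ (b2n-∧-T _ w∈F) (b2n-∧-T _ w'∈F)))
      (b2n-≢ᵇ-either _ _ _ _ ¬both)

  -- face t varies one coordinate of a vertex; P and P' collect the distances along the other two axes.
  opposite-faces-resolve : ∀ {n} (face : Fin (suc n) → Vertex n₁ n₂ n₃) (x y : Fin (suc n)) (P P' : ℕ) →
    x ≢ y → (∀ {t} → T (extremeᵇ t) → T (inFᵇ (face t))) →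
    (∀ t → dist (face t) u ≡ P + ∣ toℕ t - toℕ x ∣) →
    (∀ t → dist (face t) v ≡ P' + ∣ toℕ t - toℕ y ∣) →
    1 ≤ resolverInF (face zero) + resolverInF (face (fromℕ n))
  opposite-faces-resolve {n} face x y P P' x≢y onBoundary du dv =
    either-resolves {face zero} {face (fromℕ n)}
      (onBoundary (extremeᵇ-zero {n})) (onBoundary (extremeᵇ-fromℕ n)) λ e₀ e₁ →
        x≢y (toℕ-injective (opposite-ends-separate P P' (toℕ≤pred[n] x) (toℕ≤pred[n] y)
          (trans (sym (du zero)) (trans e₀ (dv zero)))
          (trans (sym (atLast P x))
            (trans (sym (du (fromℕ n))) (trans e₁ (trans (dv (fromℕ n)) (atLast P' y)))))))
    where
    atLast : ∀ Q z → Q + ∣ toℕ (fromℕ n) - toℕ z ∣ ≡ Q + ∣ n - toℕ z ∣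
    atLast Q z = cong (λ L → Q + ∣ L - toℕ z ∣) (toℕ-fromℕ n)

coordDist : ∀ {n} → Fin n → Fin n → ℕ
coordDist s t = ∣ toℕ s - toℕ t ∣

opposite-faces-resolve₁ : ∀ {m n₂ n₃} {x₁ y₁ : Fin (suc m)} {x₂ y₂ : Fin n₂} {x₃ y₃ : Fin n₃} →
  x₁ ≢ y₁ → ∀ j k →
  let χ = resolverInF (x₁ , x₂ , x₃) (y₁ , y₂ , y₃) in 1 ≤ χ (zero , j , k) + χ (fromℕ m , j , k)
opposite-faces-resolve₁ {x₁ = x₁} {y₁} {x₂} {y₂} {x₃} {y₃} x₁≢y₁ j k =
  opposite-faces-resolve _ _ (λ t → t , j , k) x₁ y₁
    (coordDist j x₂ + coordDist k x₃) (coordDist j y₂ + coordDist k y₃) x₁≢y₁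
    (λ t∈∂ → from T-∨ (inj₁ t∈∂))
    (λ t → xy∙z≈yz∙x (coordDist t x₁) _ _)
    (λ t → xy∙z≈yz∙x (coordDist t y₁) _ _)

opposite-faces-resolve₂ : ∀ {n₁ m n₃} {x₁ y₁ : Fin n₁} {x₂ y₂ : Fin (suc m)} {x₃ y₃ : Fin n₃} →
  x₂ ≢ y₂ → ∀ i k →
  let χ = resolverInF (x₁ , x₂ , x₃) (y₁ , y₂ , y₃) in 1 ≤ χ (i , zero , k) + χ (i , fromℕ m , k)
opposite-faces-resolve₂ {x₁ = x₁} {y₁} {x₂} {y₂} {x₃} {y₃} x₂≢y₂ i k =
  opposite-faces-resolve _ _ (λ t → i , t , k) x₂ y₂
    (coordDist i x₁ + coordDist k x₃) (coordDist i y₁ + coordDist k y₃) x₂≢y₂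
    (λ t∈∂ → from (T-∨ {extremeᵇ i}) (inj₂ (from T-∨ (inj₁ t∈∂))))
    (λ t → xy∙z≈xz∙y (coordDist i x₁) (coordDist t x₂) _)
    (λ t → xy∙z≈xz∙y (coordDist i y₁) (coordDist t y₂) _)

opposite-faces-resolve₃ : ∀ {n₁ n₂ m} {x₁ y₁ : Fin n₁} {x₂ y₂ : Fin n₂} {x₃ y₃ : Fin (suc m)} →
  x₃ ≢ y₃ → ∀ i j →
  let χ = resolverInF (x₁ , x₂ , x₃) (y₁ , y₂ , y₃) in 1 ≤ χ (i , j , zero) + χ (i , j , fromℕ m)
opposite-faces-resolve₃ {x₃ = x₃} {y₃} x₃≢y₃ i j =
  opposite-faces-resolve _ _ (λ t → i , j , t) x₃ y₃ _ _ x₃≢y₃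
    (λ t∈∂ → from (T-∨ {extremeᵇ i}) (inj₂ (from (T-∨ {extremeᵇ j}) (inj₂ t∈∂))))
    (λ t → refl) (λ t → refl)

lowerBound-differ₂₃ : ∀ {n₁ b c} {x₁ y₁ : Fin n₁} {x₂ y₂ : Fin (suc (suc b))} {x₃ y₃ : Fin (suc (suc c))} →
  x₂ ≢ y₂ → x₃ ≢ y₃ →
  n₁ * (b + suc (suc c)) ≤ numResolvingInF n₁ (suc (suc b)) (suc (suc c)) (x₁ , x₂ , x₃) (y₁ , y₂ , y₃)
lowerBound-differ₂₃ {n₁} {b} {c} {x₁} {y₁} {x₂} {y₂} {x₃} {y₃} x₂≢y₂ x₃≢y₃ = begin
  n₁ * (b + suc (suc c))
    ≤⟨ ∑-lowerBound _ (λ i → ∑-boundary-pairs (λ j k → χ (i , j , k))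
         (opposite-faces-resolve₃ x₃≢y₃ i) (opposite-faces-resolve₂ x₂≢y₂ i)) ⟩
  ∑[ i < n₁ ] ∑[ j < suc (suc b) ] ∑[ k < suc (suc c) ] χ (i , j , k)
    ≡⟨ numResolvingInF≡∑ u v ⟨
  numResolvingInF n₁ (suc (suc b)) (suc (suc c)) u v ∎
  where
  open ≤-Reasoning
  u v : Vertex n₁ (suc (suc b)) (suc (suc c))
  u = x₁ , x₂ , x₃
  v = y₁ , y₂ , y₃
  χ : Vertex n₁ (suc (suc b)) (suc (suc c)) → ℕ
  χ = resolverInF u v

lowerBound-differ₁₃ : ∀ {a n₂ c} {x₁ y₁ : Fin (suc (suc a))} {x₂ y₂ : Fin n₂} {x₃ y₃ : Fin (suc (suc c))} →
  x₁ ≢ y₁ → x₃ ≢ y₃ →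
  n₂ * (a + suc (suc c)) ≤ numResolvingInF (suc (suc a)) n₂ (suc (suc c)) (x₁ , x₂ , x₃) (y₁ , y₂ , y₃)
lowerBound-differ₁₃ {a} {n₂} {c} {x₁} {y₁} {x₂} {y₂} {x₃} {y₃} x₁≢y₁ x₃≢y₃ = begin
  n₂ * (a + suc (suc c))
    ≤⟨ ∑-lowerBound _ (λ j → ∑-boundary-pairs (λ i k → χ (i , j , k))
         (λ i → opposite-faces-resolve₃ x₃≢y₃ i j) (opposite-faces-resolve₁ x₁≢y₁ j)) ⟩
  ∑[ j < n₂ ] ∑[ i < suc (suc a) ] ∑[ k < suc (suc c) ] χ (i , j , k)
    ≡⟨ ∑-comm (λ i j → ∑[ k < suc (suc c) ] χ (i , j , k)) ⟨
  ∑[ i < suc (suc a) ] ∑[ j < n₂ ] ∑[ k < suc (suc c) ] χ (i , j , k)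
    ≡⟨ numResolvingInF≡∑ u v ⟨
  numResolvingInF (suc (suc a)) n₂ (suc (suc c)) u v ∎
  where
  open ≤-Reasoning
  u v : Vertex (suc (suc a)) n₂ (suc (suc c))
  u = x₁ , x₂ , x₃
  v = y₁ , y₂ , y₃
  χ : Vertex (suc (suc a)) n₂ (suc (suc c)) → ℕ
  χ = resolverInF u v

lowerBound-differ₁₂ : ∀ {a b n₃} {x₁ y₁ : Fin (suc (suc a))} {x₂ y₂ : Fin (suc (suc b))} {x₃ y₃ : Fin n₃} →
  x₁ ≢ y₁ → x₂ ≢ y₂ →
  n₃ * (a + suc (suc b)) ≤ numResolvingInF (suc (suc a)) (suc (suc b)) n₃ (x₁ , x₂ , x₃) (y₁ , y₂ , y₃)
lowerBound-differ₁₂ {a} {b} {n₃} {x₁} {y₁} {x₂} {y₂} {x₃} {y₃} x₁≢y₁ x₂≢y₂ = begin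
  n₃ * (a + suc (suc b))
    ≤⟨ ∑-lowerBound _ (λ k → ∑-boundary-pairs (λ i j → χ (i , j , k))
         (λ i → opposite-faces-resolve₂ x₂≢y₂ i k) (λ j → opposite-faces-resolve₁ x₁≢y₁ j k)) ⟩
  ∑[ k < n₃ ] ∑[ i < suc (suc a) ] ∑[ j < suc (suc b) ] χ (i , j , k)
    ≡⟨ ∑-comm (λ i k → ∑[ j < suc (suc b) ] χ (i , j , k)) ⟨
  ∑[ i < suc (suc a) ] ∑[ k < n₃ ] ∑[ j < suc (suc b) ] χ (i , j , k)
    ≡⟨ sum-cong-≗ {suc (suc a)} (λ i → ∑-comm (λ k j → χ (i , j , k))) ⟩
  ∑[ i < suc (suc a) ] ∑[ j < suc (suc b) ] ∑[ k < n₃ ] χ (i , j , k)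
    ≡⟨ numResolvingInF≡∑ u v ⟨
  numResolvingInF (suc (suc a)) (suc (suc b)) n₃ u v ∎
  where
  open ≤-Reasoning
  u v : Vertex (suc (suc a)) (suc (suc b)) n₃
  u = x₁ , x₂ , x₃
  v = y₁ , y₂ , y₃
  χ : Vertex (suc (suc a)) (suc (suc b)) n₃ → ℕ
  χ = resolverInF u v

exactly-one-true : ∀ a b c → b2n a + b2n b + b2n c ≡ 1 →
  (b ≡ false × c ≡ false) ⊎ (a ≡ false × c ≡ false) ⊎ (a ≡ false × b ≡ false)
exactly-one-true true false false _ = inj₁ (refl , refl)
exactly-one-true false true false _ = inj₂ (inj₁ (refl , refl))
exactly-one-true false false true _ = inj₂ (inj₂ (refl , refl))
exactly-one-true true true _ ()
exactly-one-true true false true ()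
exactly-one-true false true true ()
exactly-one-true false false false ()

toℕ-≡ᵇ-false⇒≢ : ∀ {n} (x y : Fin n) → (toℕ x ≡ᵇ toℕ y) ≡ false → x ≢ y
toℕ-≡ᵇ-false⇒≢ x y e x≡y = subst T e (≡⇒≡ᵇ _ _ (cong toℕ x≡y))

lemma9 : (n₁ n₂ n₃ : ℕ) → 2 ≤ n₁ → 2 ≤ n₂ → 2 ≤ n₃ →
    (u v : Vertex n₁ n₂ n₃) → numEqualCoords u v ≡ 1 →
    αM n₁ n₂ n₃ ≤ numResolvingInF n₁ n₂ n₃ u v
lemma9 (suc (suc a)) (suc (suc b)) (suc (suc c)) (s≤s (s≤s z≤n)) (s≤s (s≤s z≤n)) (s≤s (s≤s z≤n))
  (x₁ , x₂ , x₃) (y₁ , y₂ , y₃) oneEqual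
  with exactly-one-true (toℕ x₁ ≡ᵇ toℕ y₁) (toℕ x₂ ≡ᵇ toℕ y₂) (toℕ x₃ ≡ᵇ toℕ y₃) oneEqual
... | inj₁ (x₂≠y₂ , x₃≠y₃) =
  ≤-trans (≤-trans (m⊓n≤m _ _) (m⊓n≤m _ _))
    (lowerBound-differ₂₃ {x₁ = x₁} {y₁ = y₁} (toℕ-≡ᵇ-false⇒≢ x₂ y₂ x₂≠y₂) (toℕ-≡ᵇ-false⇒≢ x₃ y₃ x₃≠y₃))
... | inj₂ (inj₁ (x₁≠y₁ , x₃≠y₃)) =
  ≤-trans (≤-trans (m⊓n≤m _ _) (m⊓n≤n _ _))
    (lowerBound-differ₁₃ {x₂ = x₂} {y₂ = y₂} (toℕ-≡ᵇ-false⇒≢ x₁ y₁ x₁≠y₁) (toℕ-≡ᵇ-false⇒≢ x₃ y₃ x₃≠y₃))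
... | inj₂ (inj₂ (x₁≠y₁ , x₂≠y₂)) =
  ≤-trans (m⊓n≤n _ _)
    (lowerBound-differ₁₂ {x₃ = x₃} {y₃ = y₃} (toℕ-≡ᵇ-false⇒≢ x₁ y₁ x₁≠y₁) (toℕ-≡ᵇ-false⇒≢ x₂ y₂ x₂≠y₂))
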